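{- If $a,b,c\in\mathbb{Z}$ are pairwise coprime, then $a\mathbb{Z}_n\cup b\mathbb{Z}_n\cup c\mathbb{Z}_n\subseteq\mathbb{Z}_n$ is an extendable domain.
   Context: For an integer $a$, $a\mathbb{Z}_n$ denotes the set of residues modulo $n$ of the multiples of $a$, i.e. $\{ma \bmod n: m\in\mathbb{Z}\}$. A set $A\subseteq\mathbb{Z}_n$ is an extendable domain if for every function $h:A\to\mathbb{R}/\mathbb{Z}$ that is additive (i.e. $h(x+y)=h(x)+h(y)$ whenever $x,y,x+y\in A$) there exists $L\in\mathbb{R}$ with $h(k)=Lk \pmod 1$ for every $k\in A$. -}

module Defs where

open import Level using (0ℓ)
open import Data.Nat as ℕ using (ℕ; NonZero)
open import Data.Integer as ℤ using (ℤ; +_; -[1+_]; _%ℕ_)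
open import Data.Product using (Σ; ∃; _×_; _,_)
open import Data.Sum using (_⊎_)
open import Relation.Nullary using (¬_)
open import Algebra.Bundles using (CommutativeRing)

-- An axiomatisation of the real numbers: a complete ordered field.
-- (agda-stdlib has no real numbers, so the theorem is stated for every
--  model of these axioms, i.e. for ℝ up to isomorphism.)
record RealField : Set₁ where
  field
    commRing : CommutativeRing 0ℓ 0ℓ
  open CommutativeRing commRing public
  field
    nontrivial : ¬ (0# ≈ 1#)
    inverse    : ∀ x → ¬ (x ≈ 0#) → ∃ λ y → x * y ≈ 1#
    _≤_        : Carrier → Carrier → Set
    ≤-resp-≈   : ∀ {x x′ y y′} → x ≈ x′ → y ≈ y′ → x ≤ y → x′ ≤ y′
    ≤-refl     : ∀ {x} → x ≤ x
    ≤-trans    : ∀ {x y z} → x ≤ y → y ≤ z → x ≤ z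
    ≤-antisym  : ∀ {x y} → x ≤ y → y ≤ x → x ≈ y
    ≤-total    : ∀ x y → (x ≤ y) ⊎ (y ≤ x)
    +-mono-≤   : ∀ {x y} z → x ≤ y → (x + z) ≤ (y + z)
    *-nonneg   : ∀ {x y} → 0# ≤ x → 0# ≤ y → 0# ≤ (x * y)
    complete   : (P : Carrier → Set) → (∃ λ x → P x) →
                 (∃ λ u → ∀ x → P x → x ≤ u) →
                 ∃ λ s → (∀ x → P x → x ≤ s) × (∀ u → (∀ x → P x → x ≤ u) → s ≤ u)

module _ (R : RealField) where
  open RealField R

  ιℕ : ℕ → Carrier
  ιℕ ℕ.zero    = 0#
  ιℕ (ℕ.suc k) = 1# + ιℕ k

  ιℤ : ℤ → Carrier
  ιℤ (+ k)      = ιℕ k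
  ιℤ -[1+ k ]   = - (1# + ιℕ k)

  _≡mod1_ : Carrier → Carrier → Set
  x ≡mod1 y = ∃ λ (z : ℤ) → x - y ≈ ιℤ z

-- x ∈ a ℤ_n, where residues modulo n are represented by 0,…,n-1
_∈_ℤ_ : ℕ → ℤ → (n : ℕ) → .{{NonZero n}} → Set
x ∈ a ℤ n = ∃ λ (m : ℤ) → (m ℤ.* a) %ℕ n ≡ x
  where open import Relation.Binary.PropositionalEquality using (_≡_)

InDom : (n : ℕ) → .{{NonZero n}} → ℤ → ℤ → ℤ → ℕ → Set
InDom n a b c x = (x ∈ a ℤ n) ⊎ (x ∈ b ℤ n) ⊎ (x ∈ c ℤ n)

-- A function A → ℝ/ℤ is given by representatives h : ℕ → ℝ
-- (only values on A matter); addition in ℤ_n is (x + y) mod n.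
ExtendableDomain : RealField → (n : ℕ) → .{{NonZero n}} → (ℕ → Set) → Set
ExtendableDomain R n A =
  (h : ℕ → Carrier) →
  (∀ x y → A x → A y → A ((x ℕ.+ y) ℕ.% n) →
     _≡mod1_ R (h x + h y) (h ((x ℕ.+ y) ℕ.% n))) →
  ∃ λ (L : Carrier) → ∀ k → A k → _≡mod1_ R (h k) (L * ιℕ R k)
  where open RealField R

module Submission where

-- On a cyclic subgroup gℤₙ ⊆ A the map m ↦ h(mg mod n) is a homomorphism ℤ → ℝ/ℤ, so
-- h(mg mod n) = m·u_g with u_g = h(g mod n), and n·u_g = 0.  Evaluating h at g₁g₂ mod n in two
-- ways gives g₂·u_{g₁} = g₁·u_{g₂}.  Hence for a Bézout identity xa + yb = 1 the slope
-- L = x·u_a + y·u_b satisfies g·L = u_g for every generator g, and n·L = 0, so that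
-- h(mg mod n) = mg·L = (mg mod n)·L.

open import Defs
open import Data.Nat as ℕ using (ℕ; NonZero; suc; zero)
open import Data.Integer as ℤ using (ℤ; +_; -[1+_]; _⊖_; _%ℕ_; ∣_∣)
open import Data.Nat.Coprimality using (Coprime)
open import Data.Product using (_,_)
open import Data.Sum using (inj₁; inj₂)
import Relation.Binary.PropositionalEquality as ≡

module Integers where
  open import Data.Nat.DivMod using ([m+kn]%n≡m%n; m<n⇒m%n≡m)
  open import Data.Nat.Coprimality using (coprime-Bézout)
  open import Data.Nat.GCD using (module Bézout)
  open import Data.Integer using (_+_; _*_; -_; _/ℕ_)
  open import Data.Integer.DivMod using (a≡a%ℕn+[a/ℕn]*n; n%ℕd<d)
  import Data.Integer.Properties as ℤ
  open import Data.Integer.Tactic.RingSolver using (solve-∀)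
  open import Data.Product using (∃; ∃₂)
  open import Relation.Binary.PropositionalEquality
  open ≡-Reasoning

  x≡[x+dy]-dy : ∀ x d y → x ≡ (x + d * y) + - d * y
  x≡[x+dy]-dy = solve-∀

  module _ (n : ℕ) .{{_ : NonZero n}} where

    remainder-unique : ∀ r r′ d → r ℕ.< n → r′ ℕ.< n → + r′ ≡ + r + d * + n → r′ ≡ r
    remainder-unique r r′ (+ k) r<n r′<n r′≡r+kn = begin
      r′                    ≡⟨ m<n⇒m%n≡m r′<n ⟨
      r′ ℕ.% n              ≡⟨ cong (ℕ._% n) (ℤ.+-injective r′≡r+kn′) ⟩
      (r ℕ.+ k ℕ.* n) ℕ.% n ≡⟨ [m+kn]%n≡m%n r k n ⟩
      r ℕ.% n               ≡⟨ m<n⇒m%n≡m r<n ⟩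
      r                     ∎
      where
      r′≡r+kn′ : + r′ ≡ + (r ℕ.+ k ℕ.* n)
      r′≡r+kn′ = trans r′≡r+kn (sym (trans (ℤ.pos-+ r (k ℕ.* n)) (cong (_+_ (+ r)) (ℤ.pos-* k n))))
    remainder-unique r r′ d@(-[1+ k ]) r<n r′<n r′≡r+dn =
      sym (remainder-unique r′ r (- d) r′<n r<n (begin
        + r                       ≡⟨ x≡[x+dy]-dy (+ r) d (+ n) ⟩
        (+ r + d * + n) + - d * + n ≡⟨ cong (_+ - d * + n) r′≡r+dn ⟨
        + r′ + - d * + n          ∎))

    %ℕ-unique : ∀ i r q → r ℕ.< n → i ≡ + r + q * + n → i %ℕ n ≡ r
    %ℕ-unique i r q r<n i≡r+qn = remainder-unique r i′ (q + - p) r<n (n%ℕd<d i n) (begin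
      + i′                          ≡⟨ x≡[x+dy]-dy (+ i′) p (+ n) ⟩
      (+ i′ + p * + n) + - p * + n  ≡⟨ cong (_+ - p * + n) (trans (sym (a≡a%ℕn+[a/ℕn]*n i n)) i≡r+qn) ⟩
      (+ r + q * + n) + - p * + n   ≡⟨ regroup (+ r) q p (+ n) ⟩
      + r + (q + - p) * + n         ∎)
      where
      i′ = i %ℕ n
      p = i /ℕ n
      regroup : ∀ x q p y → (x + q * y) + - p * y ≡ x + (q + - p) * y
      regroup = solve-∀

    [i+qn]%ℕn≡i%ℕn : ∀ i q → (i + q * + n) %ℕ n ≡ i %ℕ n
    [i+qn]%ℕn≡i%ℕn i q = %ℕ-unique (i + q * + n) (i %ℕ n) (i /ℕ n + q) (n%ℕd<d i n) (begin
      i + q * + n                           ≡⟨ cong (_+ q * + n) (a≡a%ℕn+[a/ℕn]*n i n) ⟩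
      (+ (i %ℕ n) + (i /ℕ n) * + n) + q * + n ≡⟨ regroup (+ (i %ℕ n)) (i /ℕ n) q (+ n) ⟩
      + (i %ℕ n) + (i /ℕ n + q) * + n       ∎)
      where
      regroup : ∀ x p q y → (x + p * y) + q * y ≡ x + (p + q) * y
      regroup = solve-∀

    %ℕ-distribˡ-+ : ∀ i j → (i + j) %ℕ n ≡ (i %ℕ n ℕ.+ j %ℕ n) ℕ.% n
    %ℕ-distribˡ-+ i j = begin
      (i + j) %ℕ n                                   ≡⟨ cong₂ (λ i j → (i + j) %ℕ n) (a≡a%ℕn+[a/ℕn]*n i n) (a≡a%ℕn+[a/ℕn]*n j n) ⟩
      ((+ i′ + p * + n) + (+ j′ + q * + n)) %ℕ n     ≡⟨ cong (_%ℕ n) (regroup (+ i′) p (+ j′) q (+ n)) ⟩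
      ((+ i′ + + j′) + (p + q) * + n) %ℕ n           ≡⟨ [i+qn]%ℕn≡i%ℕn (+ i′ + + j′) (p + q) ⟩
      (+ i′ + + j′) %ℕ n                             ≡⟨ cong (_%ℕ n) (ℤ.pos-+ i′ j′) ⟨
      (i′ ℕ.+ j′) ℕ.% n                              ∎
      where
      i′ = i %ℕ n
      j′ = j %ℕ n
      p = i /ℕ n
      q = j /ℕ n
      regroup : ∀ x p y q z → (x + p * z) + (y + q * z) ≡ (x + y) + (p + q) * z
      regroup = solve-∀

    n*i%ℕn≡0*i%ℕn : ∀ i → (+ n * i) %ℕ n ≡ (+ 0 * i) %ℕ n
    n*i%ℕn≡0*i%ℕn i = begin
      (+ n * i) %ℕ n         ≡⟨ cong (_%ℕ n) (rearrange (+ n) i) ⟩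
      (+ 0 + i * + n) %ℕ n   ≡⟨ [i+qn]%ℕn≡i%ℕn (+ 0) i ⟩
      (+ 0) %ℕ n             ≡⟨ cong (_%ℕ n) (ℤ.*-zeroˡ i) ⟨
      (+ 0 * i) %ℕ n         ∎
      where
      rearrange : ∀ m i → m * i ≡ + 0 + i * m
      rearrange = solve-∀

  ℕ-Bézout⇒ℤ-Bézout : ∀ x m y n → 1 ℕ.+ y ℕ.* n ≡ x ℕ.* m → + x * + m + - + y * + n ≡ + 1
  ℕ-Bézout⇒ℤ-Bézout x m y n 1+yn≡xm = begin
    + x * + m + - + y * + n         ≡⟨ cong (_+ - + y * + n) xm≡1+yn ⟩
    (+ 1 + + y * + n) + - + y * + n ≡⟨ cancel (+ y) (+ n) ⟩
    + 1                             ∎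
    where
    cancel : ∀ y n → (+ 1 + y * n) + - y * n ≡ + 1
    cancel = solve-∀
    xm≡1+yn : + x * + m ≡ + 1 + + y * + n
    xm≡1+yn = begin
      + x * + m         ≡⟨ ℤ.pos-* x m ⟨
      + (x ℕ.* m)       ≡⟨ cong +_ 1+yn≡xm ⟨
      + (1 ℕ.+ y ℕ.* n) ≡⟨ ℤ.pos-+ 1 (y ℕ.* n) ⟩
      + 1 + + (y ℕ.* n) ≡⟨ cong (_+_ (+ 1)) (ℤ.pos-* y n) ⟩
      + 1 + + y * + n   ∎

  coprime⇒ℤ-Bézout : ∀ {m n} → Coprime m n → ∃₂ λ x y → x * + m + y * + n ≡ + 1
  coprime⇒ℤ-Bézout c with coprime-Bézout c
  ... | Bézout.+- x y eq = + x , - + y , ℕ-Bézout⇒ℤ-Bézout x _ y _ eq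
  ... | Bézout.-+ x y eq =
    - + x , + y , trans (ℤ.+-comm (- + x * + _) (+ y * + _)) (ℕ-Bézout⇒ℤ-Bézout y _ x _ eq)

  ∣i∣≡s*i : ∀ i → ∃ λ s → + ∣ i ∣ ≡ s * i
  ∣i∣≡s*i (+ k)    = + 1 , sym (ℤ.*-identityˡ (+ k))
  ∣i∣≡s*i -[1+ k ] = ℤ.-1ℤ , sym (ℤ.-1*i≡-i -[1+ k ])

  coprime⇒Bézout : ∀ a b → Coprime ∣ a ∣ ∣ b ∣ → ∃₂ λ x y → x * a + y * b ≡ + 1
  coprime⇒Bézout a b c with coprime⇒ℤ-Bézout c | ∣i∣≡s*i a | ∣i∣≡s*i b
  ... | x , y , e | s , ∣a∣≡sa | t , ∣b∣≡tb = x * s , y * t , (begin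
    x * s * a + y * t * b           ≡⟨ reassoc x s a y t b ⟩
    x * (s * a) + y * (t * b)       ≡⟨ cong₂ (λ u v → x * u + y * v) ∣a∣≡sa ∣b∣≡tb ⟨
    x * + ∣ a ∣ + y * + ∣ b ∣       ≡⟨ e ⟩
    + 1                             ∎)
    where
    reassoc : ∀ x s a y t b → x * s * a + y * t * b ≡ x * (s * a) + y * (t * b)
    reassoc = solve-∀

module Embedding (R : RealField) where
  open import Data.Maybe using (Maybe; just; nothing)
  open import Relation.Nullary using (yes; no)
  import Data.Integer.Properties as ℤ
  import Algebra.Solver.Ring
  open import Algebra.Solver.Ring.AlmostCommutativeRing using (_-Raw-AlmostCommutative⟶_; fromCommutativeRing)
  open RealField R
  open import Algebra.Properties.Ring ring using (-‿involutive; -0#≈0#; -‿+-comm; -‿distribˡ-*; -‿distribʳ-*)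
  open import Algebra.Properties.Semiring.Mult semiring using (_×_; ×-homo-+; ×1-homo-*)
  open import Algebra.Solver.CommutativeMonoid +-commutativeMonoid as CM using (_⊕_; _⊜_)
  open import Relation.Binary.Reasoning.Setoid setoid

  ι = ιℤ R

  private
    ιn = ιℕ R

  ιℕ≡×1# : ∀ k → ιn k ≡.≡ k × 1#
  ιℕ≡×1# zero    = ≡.refl
  ιℕ≡×1# (suc k) = ≡.cong (_+_ 1#) (ιℕ≡×1# k)

  ιℕ-+ : ∀ m k → ιn (m ℕ.+ k) ≈ ιn m + ιn k
  ιℕ-+ m k = begin
    ιn (m ℕ.+ k)       ≡⟨ ιℕ≡×1# (m ℕ.+ k) ⟩
    (m ℕ.+ k) × 1#     ≈⟨ ×-homo-+ 1# m k ⟩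
    m × 1# + k × 1#    ≡⟨ ≡.cong₂ _+_ (ιℕ≡×1# m) (ιℕ≡×1# k) ⟨
    ιn m + ιn k        ∎

  ιℕ-* : ∀ m k → ιn (m ℕ.* k) ≈ ιn m * ιn k
  ιℕ-* m k = begin
    ιn (m ℕ.* k)       ≡⟨ ιℕ≡×1# (m ℕ.* k) ⟩
    (m ℕ.* k) × 1#     ≈⟨ ×1-homo-* m k ⟩
    m × 1# * k × 1#    ≡⟨ ≡.cong₂ _*_ (ιℕ≡×1# m) (ιℕ≡×1# k) ⟨
    ιn m * ιn k        ∎

  ιℤ-1 : ι (+ 1) ≈ 1#
  ιℤ-1 = +-identityʳ 1#

  ιℤ-neg : ∀ i → ι (ℤ.- i) ≈ - ι i
  ιℤ-neg (+ zero)  = sym -0#≈0#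
  ιℤ-neg (+ suc k) = refl
  ιℤ-neg -[1+ k ]  = sym (-‿involutive _)

  [z+x]-[z+y]≈x-y : ∀ z x y → (z + x) - (z + y) ≈ x - y
  [z+x]-[z+y]≈x-y z x y = begin
    (z + x) - (z + y)        ≈⟨ +-congˡ (-‿+-comm z y) ⟨
    (z + x) + (- z + - y)    ≈⟨ CM.solve 4 (λ z x z′ y → ((z ⊕ x) ⊕ (z′ ⊕ y)) ⊜ ((z ⊕ z′) ⊕ (x ⊕ y)))
                                         refl z x (- z) (- y) ⟩
    (z - z) + (x - y)        ≈⟨ +-congʳ (-‿inverseʳ z) ⟩
    0# + (x - y)             ≈⟨ +-identityˡ (x - y) ⟩
    x - y                    ∎

  ιℤ-⊖ : ∀ m k → ι (m ⊖ k) ≈ ιn m - ιn k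
  ιℤ-⊖ m       zero    = trans (sym (+-identityʳ _)) (+-cong refl (sym -0#≈0#))
  ιℤ-⊖ zero    (suc k) = sym (+-identityˡ _)
  ιℤ-⊖ (suc m) (suc k) = begin
    ι (suc m ⊖ suc k)            ≡⟨ ≡.cong ι (ℤ.[1+m]⊖[1+n]≡m⊖n m k) ⟩
    ι (m ⊖ k)                    ≈⟨ ιℤ-⊖ m k ⟩
    ιn m - ιn k                  ≈⟨ [z+x]-[z+y]≈x-y 1# (ιn m) (ιn k) ⟨
    (1# + ιn m) - (1# + ιn k)    ∎

  ιℤ-+ : ∀ i j → ι (i ℤ.+ j) ≈ ι i + ι j
  ιℤ-+ (+ m)    (+ k)    = ιℕ-+ m k
  ιℤ-+ (+ m)    -[1+ k ] = ιℤ-⊖ m (suc k)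
  ιℤ-+ -[1+ m ] (+ k)    = trans (ιℤ-⊖ k (suc m)) (+-comm _ _)
  ιℤ-+ -[1+ m ] -[1+ k ] = begin
    - (1# + ιn (suc (m ℕ.+ k)))        ≈⟨ -‿cong (+-congˡ (+-congˡ (ιℕ-+ m k))) ⟩
    - (1# + (1# + (ιn m + ιn k)))      ≈⟨ -‿cong (CM.solve 3 (λ o x y → (o ⊕ (o ⊕ (x ⊕ y))) ⊜ ((o ⊕ x) ⊕ (o ⊕ y)))
                                                           refl 1# (ιn m) (ιn k)) ⟩
    - ((1# + ιn m) + (1# + ιn k))      ≈⟨ -‿+-comm _ _ ⟨
    - (1# + ιn m) + - (1# + ιn k)      ∎

  ιℤ-pos-* : ∀ m j → ι (+ m ℤ.* j) ≈ ιn m * ι j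
  ιℤ-pos-* m (+ k) = trans (reflexive (≡.cong ι (≡.sym (ℤ.pos-* m k)))) (ιℕ-* m k)
  ιℤ-pos-* m -[1+ k ] = begin
    ι (+ m ℤ.* -[1+ k ])          ≡⟨ ≡.cong ι (ℤ.neg-distribʳ-* (+ m) (+ suc k)) ⟨
    ι (ℤ.- (+ m ℤ.* + suc k))     ≈⟨ ιℤ-neg (+ m ℤ.* + suc k) ⟩
    - ι (+ m ℤ.* + suc k)         ≈⟨ -‿cong (ιℤ-pos-* m (+ suc k)) ⟩
    - (ιn m * ιn (suc k))         ≈⟨ -‿distribʳ-* _ _ ⟩
    ιn m * - (1# + ιn k)          ∎

  ιℤ-* : ∀ i j → ι (i ℤ.* j) ≈ ι i * ι j
  ιℤ-* (+ m) j = ιℤ-pos-* m j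
  ιℤ-* -[1+ m ] j = begin
    ι (-[1+ m ] ℤ.* j)            ≡⟨ ≡.cong ι (ℤ.neg-distribˡ-* (+ suc m) j) ⟨
    ι (ℤ.- (+ suc m ℤ.* j))       ≈⟨ ιℤ-neg (+ suc m ℤ.* j) ⟩
    - ι (+ suc m ℤ.* j)           ≈⟨ -‿cong (ιℤ-pos-* (suc m) j) ⟩
    - (ιn (suc m) * ι j)          ≈⟨ -‿distribˡ-* _ _ ⟩
    - (1# + ιn m) * ι j           ∎

  ιℤ-homomorphism : ℤ.+-*-rawRing -Raw-AlmostCommutative⟶ fromCommutativeRing commRing
  ιℤ-homomorphism = record
    { ⟦_⟧ = ι ; +-homo = ιℤ-+ ; *-homo = ιℤ-* ; -‿homo = ιℤ-neg ; 0-homo = refl ; 1-homo = ιℤ-1 }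

  ιℤ-≟ : ∀ i j → Maybe (ι i ≈ ι j)
  ιℤ-≟ i j with i ℤ.≟ j
  ... | yes i≡j = just (reflexive (≡.cong ι i≡j))
  ... | no  _   = nothing

  module ℤ-Solver = Algebra.Solver.Ring ℤ.+-*-rawRing (fromCommutativeRing commRing) ιℤ-homomorphism ιℤ-≟

module ModOne (R : RealField) where
  open import Level using (0ℓ)
  open import Relation.Binary.Bundles using (Setoid)
  open RealField R
  open Embedding R
  open ℤ-Solver using (solve; _:+_; _:*_; _:-_; :-_; _:=_)
  open import Relation.Binary.Reasoning.Setoid setoid

  infix 4 _~_
  _~_ : Carrier → Carrier → Set
  _~_ = _≡mod1_ R

  ≈⇒≡mod1 : ∀ {x y} → x ≈ y → x ~ y
  ≈⇒≡mod1 {x} {y} x≈y = + 0 , trans (+-congʳ x≈y) (-‿inverseʳ y)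

  ≡mod1-sym : ∀ {x y} → x ~ y → y ~ x
  ≡mod1-sym {x} {y} (z , x-y≈z) = ℤ.- z , (begin
    y - x      ≈⟨ solve 2 (λ x y → (y :- x) := (:- (x :- y))) refl x y ⟩
    - (x - y)  ≈⟨ -‿cong x-y≈z ⟩
    - ι z      ≈⟨ ιℤ-neg z ⟨
    ι (ℤ.- z)  ∎)

  ≡mod1-trans : ∀ {x y w} → x ~ y → y ~ w → x ~ w
  ≡mod1-trans {x} {y} {w} (z , x-y≈z) (z′ , y-w≈z′) = z ℤ.+ z′ , (begin
    x - w              ≈⟨ solve 3 (λ x y w → (x :- w) := ((x :- y) :+ (y :- w))) refl x y w ⟩
    (x - y) + (y - w)  ≈⟨ +-cong x-y≈z y-w≈z′ ⟩
    ι z + ι z′         ≈⟨ ιℤ-+ z z′ ⟨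
    ι (z ℤ.+ z′)       ∎)

  ≡mod1-setoid : Setoid 0ℓ 0ℓ
  ≡mod1-setoid = record
    { Carrier       = Carrier
    ; _≈_           = _~_
    ; isEquivalence = record { refl = ≈⇒≡mod1 refl ; sym = ≡mod1-sym ; trans = ≡mod1-trans }
    }

  ≡mod1-+ : ∀ {x x′ y y′} → x ~ x′ → y ~ y′ → x + y ~ x′ + y′
  ≡mod1-+ {x} {x′} {y} {y′} (z , x-x′≈z) (z′ , y-y′≈z′) = z ℤ.+ z′ , (begin
    (x + y) - (x′ + y′)   ≈⟨ solve 4 (λ x x′ y y′ → ((x :+ y) :- (x′ :+ y′)) := ((x :- x′) :+ (y :- y′)))
                                  refl x x′ y y′ ⟩
    (x - x′) + (y - y′)   ≈⟨ +-cong x-x′≈z y-y′≈z′ ⟩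
    ι z + ι z′            ≈⟨ ιℤ-+ z z′ ⟨
    ι (z ℤ.+ z′)          ∎)

  ≡mod1-ιℤ* : ∀ m {x y} → x ~ y → ι m * x ~ ι m * y
  ≡mod1-ιℤ* m {x} {y} (z , x-y≈z) = m ℤ.* z , (begin
    ι m * x - ι m * y   ≈⟨ solve 3 (λ m x y → ((m :* x) :- (m :* y)) := (m :* (x :- y))) refl (ι m) x y ⟩
    ι m * (x - y)       ≈⟨ *-congˡ x-y≈z ⟩
    ι m * ι z           ≈⟨ ιℤ-* m z ⟨
    ι (m ℤ.* z)         ∎)

module AdditiveMaps (R : RealField) where
  open import Data.Integer.DivMod using (a≡a%ℕn+[a/ℕn]*n)
  open RealField R
  open Embedding R
  open ℤ-Solver using (solve; _:+_; _:*_; _:-_; con; _:=_)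
  open ModOne R
  open import Relation.Binary.Reasoning.Setoid ≡mod1-setoid

  additive⇒linear : (f : ℤ → Carrier) → (∀ i j → f i + f j ~ f (i ℤ.+ j)) →
                    ∀ i → f i ~ ι i * f (+ 1)
  additive⇒linear f additive = linear
    where
    u = f (+ 1)

    Linear : ℤ → Set
    Linear i = f i ~ ι i * u

    linear-0 : Linear (+ 0)
    linear-0 = begin
      f (+ 0)                       ≈⟨ ≈⇒≡mod1 (solve 1 (λ x → x := ((x :+ x) :- x)) refl (f (+ 0))) ⟩
      (f (+ 0) + f (+ 0)) - f (+ 0) ≈⟨ ≡mod1-+ (additive (+ 0) (+ 0)) (≈⇒≡mod1 refl) ⟩
      f (+ 0) - f (+ 0)             ≈⟨ ≈⇒≡mod1 (-‿inverseʳ (f (+ 0))) ⟩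
      0#                            ≈⟨ ≈⇒≡mod1 (zeroˡ u) ⟨
      ι (+ 0) * u                   ∎

    ι[1+i]*u : ∀ i → ι (+ 1 ℤ.+ i) * u ≈ u + ι i * u
    ι[1+i]*u i = trans (*-congʳ (ιℤ-+ (+ 1) i))
                       (solve 2 (λ x u → ((con (+ 1) :+ x) :* u) := (u :+ x :* u)) refl (ι i) u)

    up : ∀ i → Linear i → Linear (+ 1 ℤ.+ i)
    up i fi~iu = begin
      f (+ 1 ℤ.+ i)      ≈⟨ ≡mod1-sym (additive (+ 1) i) ⟩
      u + f i            ≈⟨ ≡mod1-+ (≈⇒≡mod1 refl) fi~iu ⟩
      u + ι i * u        ≈⟨ ≈⇒≡mod1 (ι[1+i]*u i) ⟨
      ι (+ 1 ℤ.+ i) * u  ∎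

    down : ∀ i → Linear (+ 1 ℤ.+ i) → Linear i
    down i f[1+i]~[1+i]u = begin
      f i                      ≈⟨ ≈⇒≡mod1 (solve 2 (λ x u → x := ((u :+ x) :- u)) refl (f i) u) ⟩
      (u + f i) - u            ≈⟨ ≡mod1-+ (additive (+ 1) i) (≈⇒≡mod1 refl) ⟩
      f (+ 1 ℤ.+ i) - u        ≈⟨ ≡mod1-+ f[1+i]~[1+i]u (≈⇒≡mod1 refl) ⟩
      ι (+ 1 ℤ.+ i) * u - u    ≈⟨ ≈⇒≡mod1 (+-congʳ (ι[1+i]*u i)) ⟩
      (u + ι i * u) - u        ≈⟨ ≈⇒≡mod1 (solve 2 (λ x u → ((u :+ x) :- u) := x) refl (ι i * u) u) ⟩
      ι i * u                  ∎

    -- Stepping by + 1 ℤ.+ i rather than i ℤ.+ + 1 because + 1 ℤ.+ + k reduces to + suc k and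
    -- + 1 ℤ.+ -[1+ suc k ] to -[1+ k ], so the induction needs no rewriting.
    linear : ∀ i → Linear i
    linear (+ zero)      = linear-0
    linear (+ suc k)     = up (+ k) (linear (+ k))
    linear -[1+ zero ]   = down -[1+ 0 ] linear-0
    linear -[1+ suc k ]  = down -[1+ suc k ] (linear -[1+ k ])

  ι*-reduce-mod : ∀ n .{{_ : NonZero n}} {L} → ι (+ n) * L ~ 0# → ∀ i → ι i * L ~ L * ιℕ R (i %ℕ n)
  ι*-reduce-mod n {L} nL~0 i = begin
    ι i * L                         ≡⟨ ≡.cong (λ j → ι j * L) (a≡a%ℕn+[a/ℕn]*n i n) ⟩
    ι (+ r ℤ.+ q ℤ.* + n) * L       ≈⟨ ≈⇒≡mod1 (*-congʳ (trans (ιℤ-+ (+ r) (q ℤ.* + n)) (+-congˡ (ιℤ-* q (+ n))))) ⟩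
    (ι (+ r) + ι q * ι (+ n)) * L   ≈⟨ ≈⇒≡mod1 (rearrange (ι (+ r)) (ι q) (ι (+ n)) L) ⟩
    L * ι (+ r) + ι q * (ι (+ n) * L) ≈⟨ ≡mod1-+ (≈⇒≡mod1 refl) (≡mod1-ιℤ* q nL~0) ⟩
    L * ι (+ r) + ι q * 0#          ≈⟨ ≈⇒≡mod1 (trans (+-congˡ (zeroʳ (ι q))) (+-identityʳ _)) ⟩
    L * ι (+ r)                     ∎
    where
    r = i %ℕ n
    q = i ℤ./ℕ n
    rearrange : ∀ r q n L → (r + q * n) * L ≈ L * r + q * (n * L)
    rearrange = solve 4 (λ r q n L → ((r :+ q :* n) :* L) := (L :* r :+ q :* (n :* L))) refl

AdditiveOn : (R : RealField) (n : ℕ) .{{_ : NonZero n}} → (ℕ → Set) → (ℕ → RealField.Carrier R) → Set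
AdditiveOn R n A h =
  ∀ x y → A x → A y → A ((x ℕ.+ y) ℕ.% n) → _≡mod1_ R (h x + h y) (h ((x ℕ.+ y) ℕ.% n))
  where open RealField R

module AdditiveOnDomain (R : RealField) (n : ℕ) .{{_ : NonZero n}}
                        (A : ℕ → Set) (h : ℕ → RealField.Carrier R) (h-additive : AdditiveOn R n A h) where
  open RealField R
  open Embedding R
  open ℤ-Solver using (solve; _:+_; _:*_; _:=_)
  open ModOne R
  open AdditiveMaps R
  open Integers
  import Data.Integer.Properties as ℤ
  open import Relation.Binary.Reasoning.Setoid ≡mod1-setoid

  MultiplesIn : ℤ → Set
  MultiplesIn g = ∀ m → A ((m ℤ.* g) %ℕ n)

  module Multiples (g : ℤ) (g⊆A : MultiplesIn g) where
    f : ℤ → Carrier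
    f m = h ((m ℤ.* g) %ℕ n)

    u : Carrier
    u = f (+ 1)

    f-additive : ∀ i j → f i + f j ~ f (i ℤ.+ j)
    f-additive i j = ≡.subst (λ k → f i + f j ~ h k) (≡.sym [i+j]g%n)
      (h-additive _ _ (g⊆A i) (g⊆A j) (≡.subst A [i+j]g%n (g⊆A (i ℤ.+ j))))
      where
      [i+j]g%n : ((i ℤ.+ j) ℤ.* g) %ℕ n ≡.≡ ((i ℤ.* g) %ℕ n ℕ.+ (j ℤ.* g) %ℕ n) ℕ.% n
      [i+j]g%n = ≡.trans (≡.cong (_%ℕ n) (ℤ.*-distribʳ-+ g i j)) (%ℕ-distribˡ-+ n (i ℤ.* g) (j ℤ.* g))

    f-linear : ∀ m → f m ~ ι m * u
    f-linear = additive⇒linear f f-additive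

    n*u~0 : ι (+ n) * u ~ 0#
    n*u~0 = begin
      ι (+ n) * u   ≈⟨ f-linear (+ n) ⟨
      f (+ n)       ≡⟨ ≡.cong h (n*i%ℕn≡0*i%ℕn n g) ⟩
      f (+ 0)       ≈⟨ f-linear (+ 0) ⟩
      ι (+ 0) * u   ≈⟨ ≈⇒≡mod1 (zeroˡ u) ⟩
      0#            ∎

  open Multiples using (u; f-linear; n*u~0)

  u-cross : ∀ g₁ (g₁⊆A : MultiplesIn g₁) g₂ (g₂⊆A : MultiplesIn g₂) →
            ι g₂ * u g₁ g₁⊆A ~ ι g₁ * u g₂ g₂⊆A
  u-cross g₁ g₁⊆A g₂ g₂⊆A = begin
    ι g₂ * u g₁ g₁⊆A        ≈⟨ f-linear g₁ g₁⊆A g₂ ⟨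
    h ((g₂ ℤ.* g₁) %ℕ n)    ≡⟨ ≡.cong (λ k → h (k %ℕ n)) (ℤ.*-comm g₂ g₁) ⟩
    h ((g₁ ℤ.* g₂) %ℕ n)    ≈⟨ f-linear g₂ g₂⊆A g₁ ⟩
    ι g₁ * u g₂ g₂⊆A        ∎

  module Slope {a b x y : ℤ} (a⊆A : MultiplesIn a) (b⊆A : MultiplesIn b)
               (xa+yb≡1 : x ℤ.* a ℤ.+ y ℤ.* b ≡.≡ + 1) where
    ua = u a a⊆A
    ub = u b b⊆A

    L : Carrier
    L = ι x * ua + ι y * ub

    ι*L-distrib : ∀ t → ι t * L ≈ ι x * (ι t * ua) + ι y * (ι t * ub)
    ι*L-distrib t = solve 5 (λ t x y p q → (t :* (x :* p :+ y :* q)) := (x :* (t :* p) :+ y :* (t :* q)))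
                          refl (ι t) (ι x) (ι y) ua ub

    g*L~u : ∀ g (g⊆A : MultiplesIn g) → ι g * L ~ u g g⊆A
    g*L~u g g⊆A = begin
      ι g * L                                  ≈⟨ ≈⇒≡mod1 (ι*L-distrib g) ⟩
      ι x * (ι g * ua) + ι y * (ι g * ub)      ≈⟨ ≡mod1-+ (≡mod1-ιℤ* x (u-cross a a⊆A g g⊆A))
                                                          (≡mod1-ιℤ* y (u-cross b b⊆A g g⊆A)) ⟩
      ι x * (ι a * ug) + ι y * (ι b * ug)      ≈⟨ ≈⇒≡mod1 (collect (ι x) (ι y) (ι a) (ι b) ug) ⟩
      (ι x * ι a + ι y * ι b) * ug             ≈⟨ ≈⇒≡mod1 (*-congʳ (trans (ιℤ-+ (x ℤ.* a) (y ℤ.* b)) (+-cong (ιℤ-* x a) (ιℤ-* y b)))) ⟨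
      ι (x ℤ.* a ℤ.+ y ℤ.* b) * ug            ≡⟨ ≡.cong (λ t → ι t * ug) xa+yb≡1 ⟩
      ι (+ 1) * ug                             ≈⟨ ≈⇒≡mod1 (trans (*-congʳ ιℤ-1) (*-identityˡ ug)) ⟩
      ug                                       ∎
      where
      ug = u g g⊆A
      collect : ∀ x y a b u → x * (a * u) + y * (b * u) ≈ (x * a + y * b) * u
      collect = solve 5 (λ x y a b u → (x :* (a :* u) :+ y :* (b :* u)) := ((x :* a :+ y :* b) :* u)) refl

    n*L~0 : ι (+ n) * L ~ 0#
    n*L~0 = begin
      ι (+ n) * L                               ≈⟨ ≈⇒≡mod1 (ι*L-distrib (+ n)) ⟩
      ι x * (ι (+ n) * ua) + ι y * (ι (+ n) * ub) ≈⟨ ≡mod1-+ (≡mod1-ιℤ* x (n*u~0 a a⊆A)) (≡mod1-ιℤ* y (n*u~0 b b⊆A)) ⟩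
      ι x * 0# + ι y * 0#                       ≈⟨ ≈⇒≡mod1 (+-cong (zeroʳ (ι x)) (zeroʳ (ι y))) ⟩
      0# + 0#                                   ≈⟨ ≈⇒≡mod1 (+-identityˡ 0#) ⟩
      0#                                        ∎

    h-linear : ∀ g (g⊆A : MultiplesIn g) m → h ((m ℤ.* g) %ℕ n) ~ L * ιℕ R ((m ℤ.* g) %ℕ n)
    h-linear g g⊆A m = begin
      h ((m ℤ.* g) %ℕ n)         ≈⟨ f-linear g g⊆A m ⟩
      ι m * u g g⊆A              ≈⟨ ≡mod1-ιℤ* m (g*L~u g g⊆A) ⟨
      ι m * (ι g * L)            ≈⟨ ≈⇒≡mod1 (*-assoc _ _ _) ⟨
      ι m * ι g * L              ≈⟨ ≈⇒≡mod1 (*-congʳ (ιℤ-* m g)) ⟨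
      ι (m ℤ.* g) * L            ≈⟨ ι*-reduce-mod n n*L~0 (m ℤ.* g) ⟩
      L * ιℕ R ((m ℤ.* g) %ℕ n)  ∎

lemma10 : (R : RealField) (n : ℕ) .{{_ : NonZero n}} (a b c : ℤ) →
          Coprime ∣ a ∣ ∣ b ∣ → Coprime ∣ b ∣ ∣ c ∣ → Coprime ∣ a ∣ ∣ c ∣ →
          ExtendableDomain R n (InDom n a b c)
lemma10 R n a b c a⊥b _ _ h h-additive with Integers.coprime⇒Bézout a b a⊥b
... | x , y , xa+yb≡1 = L , h-linear-on-A
  where
  open AdditiveOnDomain R n (InDom n a b c) h h-additive
  a⊆A : MultiplesIn a
  a⊆A m = inj₁ (m , ≡.refl)
  b⊆A : MultiplesIn b
  b⊆A m = inj₂ (inj₁ (m , ≡.refl))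
  c⊆A : MultiplesIn c
  c⊆A m = inj₂ (inj₂ (m , ≡.refl))
  open Slope {x = x} {y = y} a⊆A b⊆A xa+yb≡1
  h-linear-on-A : ∀ k → InDom n a b c k → _≡mod1_ R (h k) (RealField._*_ R L (ιℕ R k))
  h-linear-on-A _ (inj₁ (m , ≡.refl))        = h-linear a a⊆A m
  h-linear-on-A _ (inj₂ (inj₁ (m , ≡.refl))) = h-linear b b⊆A m
  h-linear-on-A _ (inj₂ (inj₂ (m , ≡.refl))) = h-linear c c⊆A m
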